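{- We have $c(1,0)=1$. For odd $n\ge 3$ and integers $d\ge 0$: if $d>(n-1)/2$ then $c(n,d)=0$, and otherwise $c(n,d)=2E(n-1,d-1)$.
   Context: For a cycle $\mathfrak c=(c_1,\dots,c_k)$, let $\mathrm{cA}(\mathfrak c)$ be the number of $i\in\{1,\dots,k\}$ with $c_i\le c_{i+1}$ and $\mathrm{cD}(\mathfrak c)$ the number with $c_i>c_{i+1}$, where $c_{k+1}=c_1$; let $M(\mathfrak c)=\min(\mathrm{cA}(\mathfrak c),\mathrm{cD}(\mathfrak c))$. $c(n,d)$ denotes the number of $n$-cycles $\mathfrak c$ in $S_n$ with $M(\mathfrak c)=d$. $E(m,e)$ is the number of permutations of $[m]$ with exactly $e$ descents (positions $i$ with $\pi_i>\pi_{i+1}$); in particular $E(m,-1)=0$. -}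

module Defs where

open import Data.Nat using (ℕ; zero; suc; _+_; _*_; _∸_; _≤?_; _<?_; _%_)
open import Data.Nat.Properties using ()
open import Data.Integer using (ℤ; +_)
open import Data.Fin using (Fin; toℕ)
open import Data.Fin using () renaming (_≟_ to _≟ᶠ_)
open import Data.List using (List; []; _∷_; [_]; map; concatMap; allFin; length; filter; upTo)
open import Data.List.Relation.Unary.Unique.Propositional using (Unique)
open import Data.List.Relation.Unary.All using (All)
open import Data.List.Relation.Unary.All using () renaming (all? to all?)
open import Data.Vec using (Vec; []; _∷_; lookup; toList)
open import Data.Product using (_×_)
open import Relation.Nullary using (Dec; ¬_; yes; no)
open import Relation.Nullary.Decidable using (_×-dec_; ¬?)
open import Relation.Binary.PropositionalEquality using (_≡_)
import Data.Integer as ℤ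
import Data.List.Relation.Unary.Unique.DecPropositional

allVecs : (n m : ℕ) → List (Vec (Fin m) n)
allVecs zero    m = [ [] ]
allVecs (suc n) m = concatMap (λ x → map (x ∷_) (allVecs n m)) (allFin m)

-- A permutation of [n] in one-line notation: a word of length n over Fin n
-- with pairwise distinct entries (hence a bijection Fin n → Fin n).
IsPerm : ∀ {n} → Vec (Fin n) n → Set
IsPerm v = Unique (toList v)

isPerm? : ∀ {n} (v : Vec (Fin n) n) → Dec (IsPerm v)
isPerm? {n} v = U.unique? (toList v)
  where module U = Data.List.Relation.Unary.Unique.DecPropositional (_≟ᶠ_ {n})

iter : ∀ {n} → Vec (Fin n) n → ℕ → Fin n → Fin n
iter σ zero    x = x
iter σ (suc k) x = lookup σ (iter σ k x)

posRange : ℕ → List ℕ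
posRange n = filter (λ i → 1 ≤? i) (upTo n)

-- σ ∈ S_(suc k) is an n-cycle (n = suc k) iff σ^i(0) ≠ 0 for all 1 ≤ i < n
-- (the orbit of the element 0 has size n).
IsNCycle : ∀ {k} → Vec (Fin (suc k)) (suc k) → Set
IsNCycle {k} σ = All (λ i → ¬ (iter σ i Fin.zero ≡ Fin.zero)) (posRange (suc k))
  where import Data.Fin as Fin

isNCycle? : ∀ {k} (σ : Vec (Fin (suc k)) (suc k)) → Dec (IsNCycle σ)
isNCycle? {k} σ = all? (λ i → ¬? (iter σ i Fin.zero ≟ᶠ Fin.zero)) (posRange (suc k))
  where import Data.Fin as Fin

-- For an n-cycle σ, write it as the cycle (c_1,…,c_n) with c_1 = 0 and
-- c_{i+1} = σ(c_i); 0-based: cyc σ i = c_{i+1} = σ^i(0).  Indices are taken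
-- cyclically (c_{n+1} = c_1) via  i % n.
cyc : ∀ {k} → Vec (Fin (suc k)) (suc k) → ℕ → ℕ
cyc {k} σ i = toℕ (iter σ (i % suc k) Fin.zero)
  where import Data.Fin as Fin

cA : ∀ {k} → Vec (Fin (suc k)) (suc k) → ℕ
cA {k} σ = length (filter (λ i → cyc σ i ≤? cyc σ (suc i)) (upTo (suc k)))

cD : ∀ {k} → Vec (Fin (suc k)) (suc k) → ℕ
cD {k} σ = length (filter (λ i → cyc σ (suc i) <? cyc σ i) (upTo (suc k)))

M : ∀ {k} → Vec (Fin (suc k)) (suc k) → ℕ
M σ = Data.Nat._⊓_ (cA σ) (cD σ)
  where import Data.Nat

c : ℕ → ℕ → ℕ
c zero    d = 0  -- not used (the statement concerns n ≥ 1)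
c (suc k) d = length (filter (λ σ → isPerm? σ ×-dec (isNCycle? σ ×-dec (M σ Data.Nat.≟ d)))
                             (allVecs (suc k) (suc k)))
  where import Data.Nat

desList : List ℕ → ℕ
desList (a ∷ b ∷ t) = indicator (b <? a) + desList (b ∷ t)
  where
  indicator : ∀ {P : Set} → Dec P → ℕ
  indicator (yes _) = 1
  indicator (no  _) = 0
desList _ = 0

des : ∀ {m} → Vec (Fin m) m → ℕ
des π = desList (map toℕ (toList π))

-- E(m,e): number of permutations of [m] with exactly e descents (e ∈ ℤ, so
-- that E(m,-1) = 0 automatically).
E : ℕ → ℤ → ℕ
E m e = length (filter (λ π → isPerm? π ×-dec ((+ des π) ℤ.≟ e)) (allVecs m m))

-- Write an n-cycle as (c₁, …, cₙ) with c₁ = 0. Its word (c₂ − 1, …, cₙ − 1) is an arbitrary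
-- permutation of [n − 1], and this is a bijection. The cyclic descents of the cycle are the
-- descents of the word plus the wrap-around cₙ > c₁ = 0, so cD = des + 1, cA = n − 1 − des and
-- M = min(n − 1 − des, des + 1). For n = 2m + 1 this lies between 1 and m, and it equals
-- d = e + 1 ≤ m exactly when des ∈ {e, 2m − 1 − e}, two distinct values. Complementing the
-- letters (x ↦ 2m − 1 − x) swaps descents and ascents, so each value is taken by E(2m, e)
-- words and c(n, d) = 2 E(2m, d − 1).

module Submission where

open import Defs
open import Data.Nat using (ℕ; zero; suc; _*_; _+_; _∸_; _≤_; _<_; _>_; z≤n; s≤s; _≤?_; _<?_; _⊓_)
import Data.Nat as ℕ
open import Data.Nat.Properties
open import Data.Nat.DivMod using (n%n≡0; m<n⇒m%n≡m)
open import Data.Nat.Solver using (module +-*-Solver)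
open import Data.Integer using (+_; _-_; 1ℤ)
import Data.Integer as ℤ
import Data.Integer.Properties as ℤ
open import Data.Fin using (Fin; zero; suc; toℕ; opposite; punchOut)
import Data.Fin.Properties as Fin
open import Data.Vec using (Vec; []; _∷_; lookup; toList; tabulate)
import Data.Vec as Vec
import Data.Vec.Properties as Vec
open import Data.Vec.Membership.Propositional.Properties using (∈-lookup; ∈-toList⁺)
open import Data.List
  using (List; []; _∷_; _++_; length; filter; map; applyUpTo; upTo; allFin; concatMap; cartesianProductWith)
open import Data.List.Properties using (length-map; filter-≐; filter-none)
open import Data.List.Membership.Propositional using (_∈_)
open import Data.List.Membership.Propositional.Properties
  using (∈-filter⁺; ∈-filter⁻; ∈-map⁺; ∈-map⁻; ∈-upTo⁺; ∈-upTo⁻; ∈-allFin; ∈-cartesianProductWith⁺)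
open import Data.List.Membership.Propositional.Properties.WithK using (unique∧set⇒bag)
open import Data.List.Relation.Unary.Any using (here; there)
open import Data.List.Relation.Unary.All using ([]; _∷_)
import Data.List.Relation.Unary.All as All
import Data.List.Relation.Unary.All.Properties as All
open import Data.List.Relation.Unary.Unique.Propositional using (Unique)
open import Data.List.Relation.Unary.AllPairs using ([]; _∷_)
import Data.List.Relation.Unary.Unique.Propositional.Properties as Unique
open import Data.List.Relation.Binary.BagAndSetEquality using (∼bag⇒↭)
open import Data.List.Relation.Binary.Permutation.Propositional.Properties using (↭-length)
open import Data.Product using (_×_; _,_; proj₂; ∃)
open import Data.Sum using (_⊎_; inj₁; inj₂; [_,_])
open import Data.Empty using (⊥-elim)
open import Function using (_∘_; case_of_)
open import Function.Definitions using (Injective)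
open import Function.Bundles using (mk⇔)
open import Relation.Binary.PropositionalEquality hiding ([_])
open import Relation.Nullary using (Dec; yes; no; ¬_; _×-dec_)
open import Relation.Binary.Definitions using (tri<; tri≈; tri>)
open import Relation.Unary using (Decidable; _⊆_; _≐_)

-- Counting elements of lists

count : ∀ {A : Set} {P : A → Set} → Decidable P → List A → ℕ
count P? xs = length (filter P? xs)

module _ {A : Set} where

  count-≐ : {P Q : A → Set} (P? : Decidable P) (Q? : Decidable Q) → P ≐ Q →
            ∀ xs → count P? xs ≡ count Q? xs
  count-≐ P? Q? P≐Q xs = cong length (filter-≐ P? Q? P≐Q xs)

  count-none : {P : A → Set} (P? : Decidable P) → (∀ x → ¬ P x) → ∀ xs → count P? xs ≡ 0
  count-none P? ¬P xs = cong length (filter-none P? (All.universal ¬P xs))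

  count-disjoint-∪ : {R P Q : A → Set} (R? : Decidable R) (P? : Decidable P) (Q? : Decidable Q) →
    R ⊆ (λ x → P x ⊎ Q x) → P ⊆ R → Q ⊆ R → (∀ {x} → P x → ¬ Q x) →
    ∀ xs → count R? xs ≡ count P? xs + count Q? xs
  count-disjoint-∪ R? P? Q? R⊆P∪Q P⊆R Q⊆R P∩Q=∅ [] = refl
  count-disjoint-∪ R? P? Q? R⊆P∪Q P⊆R Q⊆R P∩Q=∅ (x ∷ xs) with R? x | P? x | Q? x
  ... | _     | yes p | yes q = ⊥-elim (P∩Q=∅ p q)
  ... | yes _ | yes _ | no _  = cong suc (count-disjoint-∪ R? P? Q? R⊆P∪Q P⊆R Q⊆R P∩Q=∅ xs)
  ... | yes _ | no _  | yes _ =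
    trans (cong suc (count-disjoint-∪ R? P? Q? R⊆P∪Q P⊆R Q⊆R P∩Q=∅ xs)) (sym (+-suc _ _))
  ... | yes r | no ¬p | no ¬q = ⊥-elim ([ ¬p , ¬q ] (R⊆P∪Q r))
  ... | no ¬r | yes p | _     = ⊥-elim (¬r (P⊆R p))
  ... | no ¬r | no _  | yes q = ⊥-elim (¬r (Q⊆R q))
  ... | no _  | no _  | no _  = count-disjoint-∪ R? P? Q? R⊆P∪Q P⊆R Q⊆R P∩Q=∅ xs

unique-map⁺ : ∀ {A B : Set} (f : A → B) {xs : List A} →
  (∀ {a b} → a ∈ xs → b ∈ xs → f a ≡ f b → a ≡ b) → Unique xs → Unique (map f xs)
unique-map⁺ f f-inj [] = []
unique-map⁺ f f-inj (x∉xs ∷ xs!) =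
  All.map⁺ (All.tabulate (λ b∈ fx≡fb → All.lookup x∉xs b∈ (f-inj (here refl) (there b∈) fx≡fb)))
  ∷ unique-map⁺ f (λ a∈ b∈ → f-inj (there a∈) (there b∈)) xs!

count-bijection : ∀ {A B : Set} {P : A → Set} {Q : B → Set} (P? : Decidable P) (Q? : Decidable Q)
  {xs : List A} {ys : List B} → Unique xs → Unique ys →
  (f : A → B) (g : B → A) → (∀ x → f x ∈ ys) → (∀ y → g y ∈ xs) →
  P ⊆ Q ∘ f → Q ⊆ P ∘ g → (∀ {x} → P x → g (f x) ≡ x) → (∀ {y} → Q y → f (g y) ≡ y) →
  count P? xs ≡ count Q? ys
count-bijection {P = P} {Q} P? Q? {xs} {ys} xs! ys! f g f∈ g∈ f-pres g-pres gf fg =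
  trans (sym (length-map f (filter P? xs)))
        (↭-length (∼bag⇒↭ (unique∧set⇒bag image! selected! (mk⇔ to from))))
  where
  P-of : ∀ {x} → x ∈ filter P? xs → P x
  P-of x∈ = proj₂ (∈-filter⁻ P? {xs = xs} x∈)
  image! : Unique (map f (filter P? xs))
  image! = unique-map⁺ f
    (λ a∈ b∈ fa≡fb → trans (sym (gf (P-of a∈))) (trans (cong g fa≡fb) (gf (P-of b∈))))
    (Unique.filter⁺ P? xs!)
  selected! : Unique (filter Q? ys)
  selected! = Unique.filter⁺ Q? ys!
  to : ∀ {y} → y ∈ map f (filter P? xs) → y ∈ filter Q? ys
  to y∈ with ∈-map⁻ f y∈
  ... | x , x∈ , refl = ∈-filter⁺ Q? (f∈ x) (f-pres (P-of x∈))
  from : ∀ {y} → y ∈ filter Q? ys → y ∈ map f (filter P? xs)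
  from {y} y∈ = subst (_∈ map f (filter P? xs)) (fg Qy) (∈-map⁺ f (∈-filter⁺ P? (g∈ y) (g-pres Qy)))
    where Qy = proj₂ (∈-filter⁻ Q? {xs = ys} y∈)

-- Sums of indicators

indicator : ∀ {P : Set} → Dec P → ℕ
indicator (yes _) = 1
indicator (no _)  = 0

indicator-yes : ∀ {P : Set} (P? : Dec P) → P → indicator P? ≡ 1
indicator-yes (yes _) _  = refl
indicator-yes (no ¬p) p = ⊥-elim (¬p p)

indicator-no : ∀ {P : Set} (P? : Dec P) → ¬ P → indicator P? ≡ 0
indicator-no (yes p) ¬p = ⊥-elim (¬p p)
indicator-no (no _)  _  = refl

indicator-cong : ∀ {P Q : Set} (P? : Dec P) (Q? : Dec Q) → (P → Q) → (Q → P) →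
                 indicator P? ≡ indicator Q?
indicator-cong (yes _) (yes _) _   _   = refl
indicator-cong (yes p) (no ¬q) P→Q _   = ⊥-elim (¬q (P→Q p))
indicator-cong (no ¬p) (yes q) _   Q→P = ⊥-elim (¬p (Q→P q))
indicator-cong (no _)  (no _)  _   _   = refl

indicator-≤+indicator-> : ∀ a b → indicator (a ≤? b) + indicator (b <? a) ≡ 1
indicator-≤+indicator-> a b with a ≤? b | b <? a
... | yes a≤b | yes b<a = ⊥-elim (<⇒≱ b<a a≤b)
... | yes _   | no _    = refl
... | no _    | yes _   = refl
... | no a≰b  | no b≮a  = ⊥-elim (b≮a (≰⇒> a≰b))

indicator->+indicator-< : ∀ {a b} → a ≢ b → indicator (b <? a) + indicator (a <? b) ≡ 1
indicator->+indicator-< {a} {b} a≢b with b <? a | a <? b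
... | yes b<a | yes a<b = ⊥-elim (<-asym b<a a<b)
... | yes _   | no _    = refl
... | no _    | yes _   = refl
... | no b≮a  | no a≮b  = ⊥-elim (a≢b (≤-antisym (≮⇒≥ b≮a) (≮⇒≥ a≮b)))

sumBelow : ℕ → (ℕ → ℕ) → ℕ
sumBelow zero    f = 0
sumBelow (suc n) f = f 0 + sumBelow n (f ∘ suc)

sumBelow-suc : ∀ n f → sumBelow (suc n) f ≡ sumBelow n f + f n
sumBelow-suc zero    f = +-comm (f 0) 0
sumBelow-suc (suc n) f = trans (cong (λ t → f 0 + t) (sumBelow-suc n (f ∘ suc))) (sym (+-assoc (f 0) _ _))

sumBelow-cong : ∀ n {f g} → (∀ {i} → i < n → f i ≡ g i) → sumBelow n f ≡ sumBelow n g
sumBelow-cong zero    f≗g = refl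
sumBelow-cong (suc n) f≗g = cong₂ _+_ (f≗g (s≤s z≤n)) (sumBelow-cong n (f≗g ∘ s≤s))

sumBelow-+ : ∀ n f g → sumBelow n (λ i → f i + g i) ≡ sumBelow n f + sumBelow n g
sumBelow-+ zero    f g = refl
sumBelow-+ (suc n) f g rewrite sumBelow-+ n (f ∘ suc) (g ∘ suc) =
  solve 4 (λ a b c d → (a :+ b) :+ (c :+ d) := (a :+ c) :+ (b :+ d)) refl (f 0) (g 0) _ _
  where open +-*-Solver

sumBelow-one : ∀ n → sumBelow n (λ _ → 1) ≡ n
sumBelow-one zero    = refl
sumBelow-one (suc n) = cong suc (sumBelow-one n)

sumBelow-complementary : ∀ n f g → (∀ {i} → i < n → f i + g i ≡ 1) → sumBelow n f + sumBelow n g ≡ n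
sumBelow-complementary n f g f+g≡1 = begin
  sumBelow n f + sumBelow n g       ≡⟨ sumBelow-+ n f g ⟨
  sumBelow n (λ i → f i + g i)      ≡⟨ sumBelow-cong n f+g≡1 ⟩
  sumBelow n (λ _ → 1)              ≡⟨ sumBelow-one n ⟩
  n                                 ∎
  where open ≡-Reasoning

count-applyUpTo : ∀ {P : ℕ → Set} (P? : Decidable P) f n →
  count P? (applyUpTo f n) ≡ sumBelow n (λ i → indicator (P? (f i)))
count-applyUpTo P? f zero = refl
count-applyUpTo P? f (suc n) with P? (f 0)
... | yes _ = cong suc (count-applyUpTo P? (f ∘ suc) n)
... | no _  = count-applyUpTo P? (f ∘ suc) n

-- Words

concatMap-map≡cartesianProductWith : ∀ {A B C : Set} (f : A → B → C) xs ys →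
  concatMap (λ x → map (f x) ys) xs ≡ cartesianProductWith f xs ys
concatMap-map≡cartesianProductWith f []       ys = refl
concatMap-map≡cartesianProductWith f (x ∷ xs) ys =
  cong (map (f x) ys ++_) (concatMap-map≡cartesianProductWith f xs ys)

allVecs-suc : ∀ n m → allVecs (suc n) m ≡ cartesianProductWith _∷_ (allFin m) (allVecs n m)
allVecs-suc n m = concatMap-map≡cartesianProductWith _∷_ (allFin m) (allVecs n m)

allVecs-complete : ∀ {n m} (v : Vec (Fin m) n) → v ∈ allVecs n m
allVecs-complete []      = here refl
allVecs-complete {suc n} {m} (x ∷ v) = subst (x ∷ v ∈_) (sym (allVecs-suc n m))
  (∈-cartesianProductWith⁺ _∷_ (∈-allFin x) (allVecs-complete v))

allVecs-unique : ∀ n m → Unique (allVecs n m)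
allVecs-unique zero    m = [] ∷ []
allVecs-unique (suc n) m = subst Unique (sym (allVecs-suc n m))
  (Unique.cartesianProductWith⁺ _∷_ Vec.∷-injective (Unique.allFin⁺ m) (allVecs-unique n m))

lookup-extensionality : ∀ {A : Set} {n} (u v : Vec A n) → (∀ a → lookup u a ≡ lookup v a) → u ≡ v
lookup-extensionality u v u≗v = begin
  u                   ≡⟨ Vec.tabulate∘lookup u ⟨
  tabulate (lookup u) ≡⟨ Vec.tabulate-cong u≗v ⟩
  tabulate (lookup v) ≡⟨ Vec.tabulate∘lookup v ⟩
  v                   ∎
  where open ≡-Reasoning

module _ {A : Set} where

  ∈-toList⇒lookup : ∀ {n} (v : Vec A n) {y} → y ∈ toList v → ∃ λ i → lookup v i ≡ y
  ∈-toList⇒lookup (x ∷ v) (here refl) = zero , refl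
  ∈-toList⇒lookup (x ∷ v) (there y∈)  = let i , vᵢ≡y = ∈-toList⇒lookup v y∈ in suc i , vᵢ≡y

  unique⇒lookup-injective : ∀ {n} (v : Vec A n) → Unique (toList v) → Injective _≡_ _≡_ (lookup v)
  unique⇒lookup-injective (x ∷ v) v!         {zero}  {zero}  _ = refl
  unique⇒lookup-injective (x ∷ v) (x∉v ∷ _)  {zero}  {suc b} e =
    ⊥-elim (All.lookup x∉v (∈-toList⁺ (∈-lookup b v)) e)
  unique⇒lookup-injective (x ∷ v) (x∉v ∷ _)  {suc a} {zero}  e =
    ⊥-elim (All.lookup x∉v (∈-toList⁺ (∈-lookup a v)) (sym e))
  unique⇒lookup-injective (x ∷ v) (_ ∷ v!)   {suc a} {suc b} e = cong suc (unique⇒lookup-injective v v! e)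

  lookup-injective⇒unique : ∀ {n} (v : Vec A n) → Injective _≡_ _≡_ (lookup v) → Unique (toList v)
  lookup-injective⇒unique []      _     = []
  lookup-injective⇒unique (x ∷ v) v-inj =
    All.tabulate x∉v ∷ lookup-injective⇒unique v (Fin.suc-injective ∘ v-inj)
    where
    x∉v : ∀ {y} → y ∈ toList v → x ≢ y
    x∉v y∈ x≡y with ∈-toList⇒lookup v y∈
    ... | i , vᵢ≡y with v-inj {zero} {suc i} (trans x≡y (sym vᵢ≡y))
    ... | ()

injective⇒surjective : ∀ {n} (f : Fin n → Fin n) → Injective _≡_ _≡_ f → ∀ y → ∃ λ x → f x ≡ y
injective⇒surjective {suc n} f f-inj y with Fin.any? (λ x → f x Fin.≟ y)
... | yes hit = hit
... | no miss with Fin.pigeonhole (n<1+n n) (λ i → punchOut {i = y} {j = f i} (λ e → miss (i , sym e)))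
... | i , j , i<j , fᵢ≡fⱼ = ⊥-elim (<-irrefl (cong toℕ (f-inj
        (Fin.punchOut-injective {i = y} (λ e → miss (i , sym e)) (λ e → miss (j , sym e)) fᵢ≡fⱼ))) i<j)

-- Saturating conversion from ℕ; below the bound it inverts toℕ.
clamp : ∀ {j} → ℕ → Fin (suc j)
clamp {j}     zero    = zero
clamp {zero}  (suc i) = zero
clamp {suc j} (suc i) = suc (clamp {j} i)

toℕ-clamp : ∀ {j i} → i ≤ j → toℕ (clamp {j} i) ≡ i
toℕ-clamp {j}     {zero}  _         = refl
toℕ-clamp {suc j} {suc i} (s≤s i≤j) = cong suc (toℕ-clamp i≤j)

clamp-toℕ : ∀ {j} (x : Fin (suc j)) → clamp {j} (toℕ x) ≡ x
clamp-toℕ {j}     zero    = refl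
clamp-toℕ {suc j} (suc x) = cong suc (clamp-toℕ x)

at : ∀ {A : Set} {j} → Vec A (suc j) → ℕ → A
at v i = lookup v (clamp i)

at-injective : ∀ {A : Set} {j} (v : Vec A (suc j)) → Unique (toList v) →
  ∀ {i i′} → i ≤ j → i′ ≤ j → at v i ≡ at v i′ → i ≡ i′
at-injective v v! {i} {i′} i≤j i′≤j vᵢ≡vᵢ′ = begin
  i                 ≡⟨ toℕ-clamp i≤j ⟨
  toℕ (clamp i)     ≡⟨ cong toℕ (unique⇒lookup-injective v v! vᵢ≡vᵢ′) ⟩
  toℕ (clamp i′)    ≡⟨ toℕ-clamp i′≤j ⟩
  i′                ∎
  where open ≡-Reasoning

desList≡sumBelow : ∀ {k} j (v : Vec (Fin k) (suc j)) →
  desList (map toℕ (toList v)) ≡ sumBelow j (λ i → indicator (toℕ (at v (suc i)) <? toℕ (at v i)))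
desList≡sumBelow zero    (x ∷ [])    = refl
desList≡sumBelow (suc j) (x ∷ y ∷ v) with toℕ y <? toℕ x
... | yes _ = cong suc (desList≡sumBelow j (y ∷ v))
... | no _  = desList≡sumBelow j (y ∷ v)

-- An n-cycle and its word

Word : ℕ → Set
Word n = Vec (Fin n) n

orbit : ∀ {k} → Word (suc k) → ℕ → Fin (suc k)
orbit σ i = iter σ i zero

module _ {k} {σ : Word (suc k)} where

  IsNCycle⇒orbit≢0 : IsNCycle σ → ∀ {i} → 1 ≤ i → i < suc k → orbit σ i ≢ zero
  IsNCycle⇒orbit≢0 σ-cyc 1≤i i<n = All.lookup σ-cyc (∈-filter⁺ (λ i → 1 ≤? i) (∈-upTo⁺ i<n) 1≤i)

  orbit≢0⇒IsNCycle : (∀ {i} → 1 ≤ i → i < suc k → orbit σ i ≢ zero) → IsNCycle σ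
  orbit≢0⇒IsNCycle orbit≢0 = All.tabulate λ {i} i∈ →
    let i∈upTo , 1≤i = ∈-filter⁻ (λ i → 1 ≤? i) {xs = upTo (suc k)} i∈
    in  orbit≢0 1≤i (∈-upTo⁻ i∈upTo)

  cyc-< : ∀ {i} → i < suc k → cyc σ i ≡ toℕ (orbit σ i)
  cyc-< i<n = cong (λ t → toℕ (orbit σ t)) (m<n⇒m%n≡m i<n)

  cyc-wrap : cyc σ (suc k) ≡ 0
  cyc-wrap = cong (λ t → toℕ (orbit σ t)) (n%n≡0 (suc k))

  cA+cD : cA σ + cD σ ≡ suc k
  cA+cD = begin
    cA σ + cD σ
      ≡⟨ cong₂ _+_ (count-applyUpTo (λ i → cyc σ i ≤? cyc σ (suc i)) (λ i → i) (suc k))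
                   (count-applyUpTo (λ i → cyc σ (suc i) <? cyc σ i) (λ i → i) (suc k)) ⟩
    sumBelow (suc k) ascent + sumBelow (suc k) descent
      ≡⟨ sumBelow-complementary (suc k) ascent descent
           (λ {i} _ → indicator-≤+indicator-> (cyc σ i) (cyc σ (suc i))) ⟩
    suc k ∎
    where
    open ≡-Reasoning
    ascent descent : ℕ → ℕ
    ascent  i = indicator (cyc σ i ≤? cyc σ (suc i))
    descent i = indicator (cyc σ (suc i) <? cyc σ i)

unsuc : ∀ {n} → Fin (suc (suc n)) → Fin (suc n)
unsuc zero    = zero
unsuc (suc y) = y

suc-unsuc : ∀ {n} {y : Fin (suc (suc n))} → y ≢ zero → suc (unsuc y) ≡ y
suc-unsuc {y = zero}  y≢0 = ⊥-elim (y≢0 refl)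
suc-unsuc {y = suc y} _   = refl

-- Writing σ as the cycle (c₁, …, cₙ) with c₁ = 0, this is the word (c₂ − 1, …, cₙ − 1).
cycleWord : ∀ {j} → Word (suc (suc j)) → Word (suc j)
cycleWord σ = tabulate (λ x → unsuc (orbit σ (suc (toℕ x))))

-- M of an n-cycle (n = j + 2) whose word has x descents: cD = x + 1 and cA = n − cD.
minAscDes : ℕ → ℕ → ℕ
minAscDes j x = (suc j ∸ x) ⊓ suc x

Mword : ∀ {j} → Word (suc j) → ℕ
Mword {j} w = minAscDes j (des w)

allWords : ∀ n → List (Word n)
allWords n = allVecs n n

PermWith : ∀ {n} → (Word n → ℕ) → ℕ → Word n → Set
PermWith f v w = IsPerm w × f w ≡ v

permWith? : ∀ {n} (f : Word n → ℕ) v → Decidable (PermWith f v)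
permWith? f v w = isPerm? w ×-dec (f w ℕ.≟ v)

-- Junk value y when y does not occur in w.
inverse : ∀ {n} → Word n → Fin n → Fin n
inverse w y with Fin.any? (λ x → lookup w x Fin.≟ y)
... | yes (x , _) = x
... | no _        = y

lookup-inverse : ∀ {n} {w : Word n} → IsPerm w → ∀ y → lookup w (inverse w y) ≡ y
lookup-inverse {w = w} w! y with Fin.any? (λ x → lookup w x Fin.≟ y)
... | yes (_ , wₓ≡y) = wₓ≡y
... | no miss        = ⊥-elim (miss (injective⇒surjective (lookup w) (unique⇒lookup-injective w w!) y))

-- The successor map of the cycle (0, w₀ + 1, …, w_j + 1).
cycleSucc : ∀ {j} → Word (suc j) → Fin (suc (suc j)) → Fin (suc (suc j))
cycleSucc w zero = suc (at w 0)
cycleSucc {j} w (suc y) with toℕ (inverse w y) ℕ.≟ j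
... | yes _ = zero
... | no _  = suc (at w (suc (toℕ (inverse w y))))

wordCycle : ∀ {j} → Word (suc j) → Word (suc (suc j))
wordCycle w = tabulate (cycleSucc w)

cycleSucc-inner : ∀ {j} (w : Word (suc j)) y → toℕ (inverse w y) ≢ j →
                  cycleSucc w (suc y) ≡ suc (at w (suc (toℕ (inverse w y))))
cycleSucc-inner {j} w y ¬last with toℕ (inverse w y) ℕ.≟ j
... | yes last = ⊥-elim (¬last last)
... | no _     = refl

module NCycle {j} {σ : Word (suc (suc j))} (σ! : IsPerm σ) (σ-cyc : IsNCycle σ) where

  private
    n : ℕ
    n = suc (suc j)

  orbit-+-cancel : ∀ a t → orbit σ (a + t) ≡ orbit σ a → orbit σ t ≡ zero
  orbit-+-cancel zero    t e = e
  orbit-+-cancel (suc a) t e = orbit-+-cancel a t (unique⇒lookup-injective σ σ! e)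

  orbit-injective : ∀ {a b} → a < n → b < n → orbit σ a ≡ orbit σ b → a ≡ b
  orbit-injective {a} {b} a<n b<n e with <-cmp a b
  ... | tri≈ _ a≡b _ = a≡b
  ... | tri< a<b _ _ = ⊥-elim (IsNCycle⇒orbit≢0 σ-cyc (m<n⇒0<n∸m a<b) (≤-<-trans (m∸n≤m b a) b<n)
                         (orbit-+-cancel a (b ∸ a) (trans (cong (orbit σ) (m+[n∸m]≡n (<⇒≤ a<b))) (sym e))))
  ... | tri> _ _ b<a = ⊥-elim (IsNCycle⇒orbit≢0 σ-cyc (m<n⇒0<n∸m b<a) (≤-<-trans (m∸n≤m a b) a<n)
                         (orbit-+-cancel b (a ∸ b) (trans (cong (orbit σ) (m+[n∸m]≡n (<⇒≤ b<a))) e)))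

  -- σⁿ(0) is some σⁱ(0) with i < n, and i ≠ 0 would give σⁿ⁻¹(0) = σⁱ⁻¹(0).
  orbit-period : orbit σ n ≡ zero
  orbit-period with injective⇒surjective (orbit σ ∘ toℕ)
                      (λ e → Fin.toℕ-injective (orbit-injective (Fin.toℕ<n _) (Fin.toℕ<n _) e)) (orbit σ n)
  ... | zero  , σ⁰≡σⁿ = sym σ⁰≡σⁿ
  ... | suc i , σⁱ⁺¹≡σⁿ = ⊥-elim (<-irrefl (orbit-injective (<-trans (Fin.toℕ<n i) (n<1+n _)) (n<1+n _)
                            (unique⇒lookup-injective σ σ! σⁱ⁺¹≡σⁿ)) (Fin.toℕ<n i))

  orbit-suc≢0 : ∀ {i} → i ≤ j → orbit σ (suc i) ≢ zero
  orbit-suc≢0 i≤j = IsNCycle⇒orbit≢0 σ-cyc (s≤s z≤n) (s≤s (s≤s i≤j))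

  suc-lookup-cycleWord : ∀ x → suc (lookup (cycleWord σ) x) ≡ orbit σ (suc (toℕ x))
  suc-lookup-cycleWord x = trans (cong suc (Vec.lookup∘tabulate (λ y → unsuc (orbit σ (suc (toℕ y)))) x))
                                 (suc-unsuc (orbit-suc≢0 (Fin.toℕ≤pred[n] x)))

  suc-at-cycleWord : ∀ {i} → i ≤ j → suc (at (cycleWord σ) i) ≡ orbit σ (suc i)
  suc-at-cycleWord {i} i≤j = trans (suc-lookup-cycleWord (clamp i)) (cong (orbit σ ∘ suc) (toℕ-clamp i≤j))

  cycleWord-perm : IsPerm (cycleWord σ)
  cycleWord-perm = lookup-injective⇒unique (cycleWord σ) λ {a} {b} e →
    Fin.toℕ-injective (suc-injective (orbit-injective (s≤s (Fin.toℕ<n a)) (s≤s (Fin.toℕ<n b))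
      (trans (sym (suc-lookup-cycleWord a)) (trans (cong suc e) (suc-lookup-cycleWord b)))))

  cyc-suc : ∀ {i} → i ≤ j → cyc σ (suc i) ≡ suc (toℕ (at (cycleWord σ) i))
  cyc-suc i≤j = trans (cyc-< (s≤s (s≤s i≤j))) (cong toℕ (sym (suc-at-cycleWord i≤j)))

  -- Besides the descents of the word, the only cyclic descent is the wrap-around cₙ > c₁ = 0.
  cD≡suc-des : cD σ ≡ suc (des (cycleWord σ))
  cD≡suc-des = begin
    cD σ                                         ≡⟨ count-applyUpTo (λ i → cyc σ (suc i) <? cyc σ i) (λ i → i) n ⟩
    descent 0 + sumBelow (suc j) (descent ∘ suc) ≡⟨ cong₂ _+_ first (sumBelow-suc j (descent ∘ suc)) ⟩
    sumBelow j (descent ∘ suc) + descent (suc j) ≡⟨ cong₂ _+_ inner wrap ⟩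
    des (cycleWord σ) + 1                        ≡⟨ +-comm (des (cycleWord σ)) 1 ⟩
    suc (des (cycleWord σ))                      ∎
    where
    open ≡-Reasoning
    descent : ℕ → ℕ
    descent i = indicator (cyc σ (suc i) <? cyc σ i)
    first : descent 0 ≡ 0
    first = indicator-no (cyc σ 1 <? cyc σ 0)
      (λ c₂<c₁ → n≮0 (subst (cyc σ 1 <_) (cyc-< {σ = σ} (s≤s z≤n)) c₂<c₁))
    wrap : descent (suc j) ≡ 1
    wrap = indicator-yes (cyc σ n <? cyc σ (suc j))
      (subst₂ _<_ (sym cyc-wrap) (sym (cyc-< (n<1+n _))) (n≢0⇒n>0 (orbit-suc≢0 ≤-refl ∘ Fin.toℕ-injective)))
    inner : sumBelow j (descent ∘ suc) ≡ des (cycleWord σ)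
    inner = trans (sumBelow-cong j (λ {i} i<j → indicator-cong _ _
                    (λ p → ≤-pred (subst₂ _<_ (cyc-suc i<j) (cyc-suc (<⇒≤ i<j)) p))
                    (λ p → subst₂ _<_ (sym (cyc-suc i<j)) (sym (cyc-suc (<⇒≤ i<j))) (s≤s p))))
                  (sym (desList≡sumBelow j (cycleWord σ)))

  M≡Mword : M σ ≡ Mword (cycleWord σ)
  M≡Mword = cong₂ _⊓_ cA≡ cD≡suc-des
    where
    cA≡ : cA σ ≡ suc j ∸ des (cycleWord σ)
    cA≡ = trans (sym (m+n∸n≡m (cA σ) (cD σ))) (cong₂ _∸_ (cA+cD {σ = σ}) cD≡suc-des)

  private
    w : Word (suc j)
    w = cycleWord σ

  orbit-suc-inverse : ∀ y → orbit σ (suc (toℕ (inverse w y))) ≡ suc y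
  orbit-suc-inverse y = begin
    orbit σ (suc (toℕ (inverse w y))) ≡⟨ suc-at-cycleWord (Fin.toℕ≤pred[n] (inverse w y)) ⟨
    suc (at w (toℕ (inverse w y)))    ≡⟨ cong (suc ∘ lookup w) (clamp-toℕ (inverse w y)) ⟩
    suc (lookup w (inverse w y))      ≡⟨ cong suc (lookup-inverse cycleWord-perm y) ⟩
    suc y                             ∎
    where open ≡-Reasoning

  cycleSucc-cycleWord : ∀ x → cycleSucc w x ≡ lookup σ x
  cycleSucc-cycleWord zero    = suc-at-cycleWord z≤n
  cycleSucc-cycleWord (suc y) with toℕ (inverse w y) ℕ.≟ j
  ... | yes t≡j = sym (begin
    lookup σ (suc y)                        ≡⟨ cong (lookup σ) (orbit-suc-inverse y) ⟨
    orbit σ (suc (suc (toℕ (inverse w y)))) ≡⟨ cong (λ i → orbit σ (suc (suc i))) t≡j ⟩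
    orbit σ n                               ≡⟨ orbit-period ⟩
    zero                                    ∎)
    where open ≡-Reasoning
  ... | no t≢j = begin
    suc (at w (suc (toℕ (inverse w y))))
      ≡⟨ suc-at-cycleWord (≤∧≢⇒< (Fin.toℕ≤pred[n] (inverse w y)) t≢j) ⟩
    lookup σ (orbit σ (suc (toℕ (inverse w y))))
      ≡⟨ cong (lookup σ) (orbit-suc-inverse y) ⟩
    lookup σ (suc y)
      ∎
    where open ≡-Reasoning

  wordCycle-cycleWord : wordCycle w ≡ σ
  wordCycle-cycleWord = lookup-extensionality (wordCycle w) σ λ x →
    trans (Vec.lookup∘tabulate (cycleSucc w) x) (cycleSucc-cycleWord x)

module WordCycle {j} {w : Word (suc j)} (w! : IsPerm w) where

  private
    σ : Word (suc (suc j))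
    σ = wordCycle w

    ι : Fin (suc j) → Fin (suc j)
    ι = inverse w

  lookup-wordCycle : ∀ x → lookup σ x ≡ cycleSucc w x
  lookup-wordCycle = Vec.lookup∘tabulate (cycleSucc w)

  ι-injective : Injective _≡_ _≡_ ι
  ι-injective {y} {y′} e = trans (sym (lookup-inverse w! y)) (trans (cong (lookup w) e) (lookup-inverse w! y′))

  ι-at : ∀ {i} → i ≤ j → toℕ (ι (at w i)) ≡ i
  ι-at {i} i≤j = trans (cong toℕ (unique⇒lookup-injective w w! (lookup-inverse w! (at w i))))
                       (toℕ-clamp i≤j)

  ι<j : ∀ y → toℕ (ι y) ≢ j → suc (toℕ (ι y)) ≤ j
  ι<j y ¬last = ≤∧≢⇒< (Fin.toℕ≤pred[n] (ι y)) ¬last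

  orbit-wordCycle : ∀ {i} → i ≤ j → orbit σ (suc i) ≡ suc (at w i)
  orbit-wordCycle {zero}  _   = lookup-wordCycle zero
  orbit-wordCycle {suc i} i<j = begin
    lookup σ (orbit σ (suc i))          ≡⟨ cong (lookup σ) (orbit-wordCycle i≤j) ⟩
    lookup σ (suc (at w i))             ≡⟨ lookup-wordCycle (suc (at w i)) ⟩
    cycleSucc w (suc (at w i))          ≡⟨ cycleSucc-inner w (at w i) (λ e → <-irrefl (trans (sym (ι-at i≤j)) e) i<j) ⟩
    suc (at w (suc (toℕ (ι (at w i))))) ≡⟨ cong (λ t → suc (at w (suc t))) (ι-at i≤j) ⟩
    suc (at w (suc i))                  ∎
    where
    open ≡-Reasoning
    i≤j = ≤-trans (n≤1+n i) i<j

  wordCycle-isNCycle : IsNCycle σ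
  wordCycle-isNCycle = orbit≢0⇒IsNCycle orbit≢0
    where
    orbit≢0 : ∀ {i} → 1 ≤ i → i < suc (suc j) → orbit σ i ≢ zero
    orbit≢0 {suc i} _ (s≤s i<n) σⁱ⁺¹≡0 with () ← trans (sym (orbit-wordCycle (≤-pred i<n))) σⁱ⁺¹≡0

  cycleSucc-suc≢cycleSucc-zero : ∀ y → cycleSucc w (suc y) ≢ cycleSucc w zero
  cycleSucc-suc≢cycleSucc-zero y e with toℕ (ι y) ℕ.≟ j
  ... | no ¬last = case at-injective w w! (ι<j y ¬last) z≤n (Fin.suc-injective e) of λ ()

  cycleSucc-injective : Injective _≡_ _≡_ (cycleSucc w)
  cycleSucc-injective {zero}  {zero}   _ = refl
  cycleSucc-injective {zero}  {suc y}  e = ⊥-elim (cycleSucc-suc≢cycleSucc-zero y (sym e))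
  cycleSucc-injective {suc y} {zero}   e = ⊥-elim (cycleSucc-suc≢cycleSucc-zero y e)
  cycleSucc-injective {suc y} {suc y′} e with toℕ (ι y) ℕ.≟ j | toℕ (ι y′) ℕ.≟ j
  ... | yes last | yes last′ = cong suc (ι-injective (Fin.toℕ-injective (trans last (sym last′))))
  ... | yes _    | no _      = case e of λ ()
  ... | no _     | yes _     = case e of λ ()
  ... | no ¬last | no ¬last′ = cong suc (ι-injective (Fin.toℕ-injective (suc-injective
                                 (at-injective w w! (ι<j y ¬last) (ι<j y′ ¬last′) (Fin.suc-injective e)))))

  wordCycle-perm : IsPerm σ
  wordCycle-perm = lookup-injective⇒unique σ λ {x} {y} e →
    cycleSucc-injective (trans (sym (lookup-wordCycle x)) (trans e (lookup-wordCycle y)))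

  cycleWord-wordCycle : cycleWord σ ≡ w
  cycleWord-wordCycle = lookup-extensionality (cycleWord σ) w λ x → begin
    lookup (cycleWord σ) x        ≡⟨ Vec.lookup∘tabulate (λ y → unsuc (orbit σ (suc (toℕ y)))) x ⟩
    unsuc (orbit σ (suc (toℕ x))) ≡⟨ cong unsuc (orbit-wordCycle (Fin.toℕ≤pred[n] x)) ⟩
    at w (toℕ x)                  ≡⟨ cong (lookup w) (clamp-toℕ x) ⟩
    lookup w x                    ∎
    where open ≡-Reasoning


c≡count-Mword : ∀ j d → c (suc (suc j)) d ≡ count (permWith? Mword d) (allWords (suc j))
c≡count-Mword j d = count-bijection
  (λ σ → isPerm? σ ×-dec (isNCycle? σ ×-dec (M σ ℕ.≟ d))) (permWith? Mword d)
  (allVecs-unique _ _) (allVecs-unique _ _) cycleWord (wordCycle {j})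
  (allVecs-complete ∘ cycleWord) (allVecs-complete ∘ wordCycle)
  (λ { (σ! , σ-cyc , Mσ≡d) → NCycle.cycleWord-perm σ! σ-cyc ,
        trans (sym (NCycle.M≡Mword σ! σ-cyc)) Mσ≡d })
  (λ { {w} (w! , Mw≡d) → let open WordCycle w! in
       wordCycle-perm , wordCycle-isNCycle ,
       trans (NCycle.M≡Mword wordCycle-perm wordCycle-isNCycle) (trans (cong Mword cycleWord-wordCycle) Mw≡d) })
  (λ { (σ! , σ-cyc , _) → NCycle.wordCycle-cycleWord σ! σ-cyc })
  (λ { (w! , _) → WordCycle.cycleWord-wordCycle w! })

-- Arithmetic of min(cA, cD)

module _ {j x : ℕ} (x≤j : x ≤ j) where

  minAscDes-mirror : minAscDes j (j ∸ x) ≡ minAscDes j x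
  minAscDes-mirror = begin
    (suc j ∸ (j ∸ x)) ⊓ suc (j ∸ x) ≡⟨ cong₂ _⊓_ (trans (+-∸-assoc 1 (m∸n≤m j x)) (cong suc (m∸[m∸n]≡n x≤j)))
                                                  (sym (+-∸-assoc 1 x≤j)) ⟩
    suc x ⊓ (suc j ∸ x)             ≡⟨ ⊓-comm (suc x) (suc j ∸ x) ⟩
    (suc j ∸ x) ⊓ suc x             ∎
    where open ≡-Reasoning

  minAscDes≡suc⇒ : ∀ {e} → minAscDes j x ≡ suc e → x ≡ e ⊎ x ≡ j ∸ e
  minAscDes≡suc⇒ {e} min≡1+e with ⊓-sel (suc j ∸ x) (suc x)
  ... | inj₂ min≡1+x = inj₁ (suc-injective (trans (sym min≡1+x) min≡1+e))
  ... | inj₁ min≡1+j∸x = inj₂ (trans (sym (m∸[m∸n]≡n x≤j)) (cong (j ∸_) j∸x≡e))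
    where
    j∸x≡e : j ∸ x ≡ e
    j∸x≡e = suc-injective (trans (sym (+-∸-assoc 1 x≤j)) (trans (sym min≡1+j∸x) min≡1+e))

  minAscDes≢0 : minAscDes j x ≢ 0
  minAscDes≢0 rewrite +-∸-assoc 1 x≤j = λ ()

minAscDes-small : ∀ {j x} → x + x < j → minAscDes j x ≡ suc x
minAscDes-small {j} {x} 2x<j = m≥n⇒m⊓n≡n (begin
  suc x         ≤⟨ s≤s (m+n≤o⇒m≤o∸n x (<⇒≤ 2x<j)) ⟩
  suc (j ∸ x)   ≡⟨ +-∸-assoc 1 (m+n≤o⇒m≤o x (<⇒≤ 2x<j)) ⟨
  suc j ∸ x     ∎)
  where open ≤-Reasoning

minAscDes≤half : ∀ {j m} x → suc j ≡ 2 * m → minAscDes j x ≤ m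
minAscDes≤half {j} {m} x 1+j≡2m with x <? m
... | yes x<m = ≤-trans (m⊓n≤n (suc j ∸ x) (suc x)) x<m
... | no x≮m  = ≤-trans (m⊓n≤m (suc j ∸ x) (suc x)) (begin
  suc j ∸ x     ≡⟨ cong (_∸ x) 1+j≡2m ⟩
  2 * m ∸ x     ≤⟨ ∸-monoʳ-≤ (2 * m) (≮⇒≥ x≮m) ⟩
  2 * m ∸ m     ≡⟨ m+n∸m≡n m (m + 0) ⟩
  m + 0         ≡⟨ +-identityʳ m ⟩
  m             ∎)
  where open ≤-Reasoning

-- Complementation

complement : ∀ {n} → Word n → Word n
complement = Vec.map opposite

complement-involutive : ∀ {n} (w : Word n) → complement (complement w) ≡ w
complement-involutive w = begin
  Vec.map opposite (Vec.map opposite w) ≡⟨ Vec.map-∘ opposite opposite w ⟨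
  Vec.map (opposite ∘ opposite) w       ≡⟨ Vec.map-cong Fin.opposite-involutive w ⟩
  Vec.map (λ x → x) w                   ≡⟨ Vec.map-id w ⟩
  w                                     ∎
  where open ≡-Reasoning

complement-perm : ∀ {n} {w : Word n} → IsPerm w → IsPerm (complement w)
complement-perm {w = w} w! = lookup-injective⇒unique (complement w) λ {a} {b} e →
  unique⇒lookup-injective w w! (begin
    lookup w a                         ≡⟨ Fin.opposite-involutive _ ⟨
    opposite (opposite (lookup w a))   ≡⟨ cong opposite (Vec.lookup-map a opposite w) ⟨
    opposite (lookup (complement w) a) ≡⟨ cong opposite e ⟩
    opposite (lookup (complement w) b) ≡⟨ cong opposite (Vec.lookup-map b opposite w) ⟩
    opposite (opposite (lookup w b))   ≡⟨ Fin.opposite-involutive _ ⟩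
    lookup w b                         ∎)
  where open ≡-Reasoning

module _ {j} {w : Word (suc j)} (w! : IsPerm w) where

  private
    a : ℕ → ℕ
    a i = toℕ (at w i)

  -- Complementing a word of distinct letters turns every descent into an ascent and vice versa.
  des+des-complement : des w + des (complement w) ≡ j
  des+des-complement = begin
    des w + des (complement w)
      ≡⟨ cong₂ _+_ (desList≡sumBelow j w)
                   (trans (desList≡sumBelow j (complement w)) (sumBelow-cong j ascent)) ⟩
    sumBelow j (λ i → indicator (a (suc i) <? a i)) + sumBelow j (λ i → indicator (a i <? a (suc i)))
      ≡⟨ sumBelow-complementary j _ _ (λ i<j → indicator->+indicator-< (adjacent-distinct i<j)) ⟩
    j ∎
    where
    open ≡-Reasoning
    toℕ-at-complement : ∀ i → toℕ (at (complement w) i) ≡ j ∸ a i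
    toℕ-at-complement i = trans (cong toℕ (Vec.lookup-map (clamp i) opposite w)) (Fin.opposite-prop (at w i))
    adjacent-distinct : ∀ {i} → i < j → a i ≢ a (suc i)
    adjacent-distinct i<j e = 1+n≢n (sym (at-injective w w! (<⇒≤ i<j) i<j (Fin.toℕ-injective e)))
    ascent : ∀ {i} → i < j → indicator (toℕ (at (complement w) (suc i)) <? toℕ (at (complement w) i))
                            ≡ indicator (a i <? a (suc i))
    ascent {i} i<j = indicator-cong _ _
      (λ p → ∸-cancelʳ-< (subst₂ _<_ (toℕ-at-complement (suc i)) (toℕ-at-complement i) p))
      (λ p → subst₂ _<_ (sym (toℕ-at-complement (suc i))) (sym (toℕ-at-complement i))
                          (∸-monoʳ-< p (Fin.toℕ≤pred[n] (at w (suc i)))))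

  des≤ : des w ≤ j
  des≤ = subst (des w ≤_) des+des-complement (m≤m+n _ _)

  des-complement : des (complement w) ≡ j ∸ des w
  des-complement = trans (sym (m+n∸m≡n (des w) (des (complement w)))) (cong (_∸ des w) des+des-complement)

countDes : ℕ → ℕ → ℕ
countDes j e = count (permWith? des e) (allWords (suc j))

countDes-mirror : ∀ {j e} → e ≤ j → countDes j (j ∸ e) ≡ countDes j e
countDes-mirror {j} {e} e≤j = count-bijection (permWith? des (j ∸ e)) (permWith? des e)
  (allVecs-unique _ _) (allVecs-unique _ _) complement complement
  (allVecs-complete ∘ complement) (allVecs-complete ∘ complement)
  (λ { (w! , des≡j∸e) → complement-perm w! ,
        trans (des-complement w!) (trans (cong (j ∸_) des≡j∸e) (m∸[m∸n]≡n e≤j)) })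
  (λ { (w! , des≡e) → complement-perm w! , trans (des-complement w!) (cong (j ∸_) des≡e) })
  (λ _ → complement-involutive _) (λ _ → complement-involutive _)

count-Mword≡2*countDes : ∀ {j e} → e + e < j →
  count (permWith? Mword (suc e)) (allWords (suc j)) ≡ 2 * countDes j e
count-Mword≡2*countDes {j} {e} 2e<j = begin
  count (permWith? Mword (suc e)) (allWords (suc j))
    ≡⟨ count-disjoint-∪ (permWith? Mword (suc e)) (permWith? des e) (permWith? des (j ∸ e))
         (λ { (w! , M≡1+e) → Data.Sum.map (w! ,_) (w! ,_) (minAscDes≡suc⇒ (des≤ w!) M≡1+e) })
         (λ { (w! , des≡e) → w! , trans (cong (minAscDes j) des≡e) (minAscDes-small 2e<j) })
         (λ { (w! , des≡j∸e) → w! , trans (cong (minAscDes j) des≡j∸e)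
                                         (trans (minAscDes-mirror e≤j) (minAscDes-small 2e<j)) })
         (λ { (_ , des≡e) (_ , des≡j∸e) → <-irrefl (2e≡j (trans (sym des≡e) des≡j∸e)) 2e<j })
         (allWords (suc j)) ⟩
  countDes j e + countDes j (j ∸ e) ≡⟨ cong (λ t → countDes j e + t) (countDes-mirror e≤j) ⟩
  countDes j e + countDes j e       ≡⟨ cong (λ t → countDes j e + t) (+-identityʳ _) ⟨
  2 * countDes j e                  ∎
  where
  open ≡-Reasoning
  e≤j : e ≤ j
  e≤j = m+n≤o⇒m≤o e (<⇒≤ 2e<j)
  2e≡j : e ≡ j ∸ e → e + e ≡ j
  2e≡j e≡j∸e = trans (cong (λ t → e + t) e≡j∸e) (m+[n∸m]≡n e≤j)

E≡countDes : ∀ j e → E (suc j) (+ e) ≡ countDes j e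
E≡countDes j e = count-≐ (λ π → isPerm? π ×-dec ((+ des π) ℤ.≟ + e)) (permWith? des e)
  ((λ { (w! , des≡e) → w! , ℤ.+-injective des≡e }) , (λ { (w! , des≡e) → w! , cong +_ des≡e }))
  (allWords (suc j))

E-negative : ∀ m → E m (ℤ.-[1+ 0 ]) ≡ 0
E-negative m =
  count-none (λ π → isPerm? π ×-dec ((+ des π) ℤ.≟ ℤ.-[1+ 0 ])) (λ { _ (_ , ()) }) (allWords m)

c-zero : ∀ j → c (suc (suc j)) 0 ≡ 0
c-zero j = trans (c≡count-Mword j 0)
  (count-none (permWith? Mword 0) (λ { _ (w! , M≡0) → minAscDes≢0 (des≤ w!) M≡0 }) (allWords (suc j)))

c-above-half : ∀ {j m d} → suc j ≡ 2 * m → m < d → c (suc (suc j)) d ≡ 0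
c-above-half {j} {m} {d} 1+j≡2m m<d = trans (c≡count-Mword j d)
  (count-none (permWith? Mword d)
     (λ { w (_ , M≡d) → <⇒≱ m<d (subst (_≤ m) M≡d (minAscDes≤half (des w) 1+j≡2m)) })
     (allWords (suc j)))

c-suc : ∀ {j e} → e + e < j → c (suc (suc j)) (suc e) ≡ 2 * E (suc j) (+ e)
c-suc {j} {e} 2e<j = begin
  c (suc (suc j)) (suc e)                            ≡⟨ c≡count-Mword j (suc e) ⟩
  count (permWith? Mword (suc e)) (allWords (suc j)) ≡⟨ count-Mword≡2*countDes 2e<j ⟩
  2 * countDes j e                                   ≡⟨ cong (2 *_) (E≡countDes j e) ⟨
  2 * E (suc j) (+ e)                                ∎
  where open ≡-Reasoning

c-odd : ∀ m d → 1 ≤ m →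
  (d > m → c (suc (2 * m)) d ≡ 0) × (d ≤ m → c (suc (2 * m)) d ≡ 2 * E (2 * m) (+ d - 1ℤ))
c-odd m@(suc _) zero    _ = c-above-half refl , λ _ →
  trans (c-zero (ℕ.pred (2 * m))) (cong (2 *_) (sym (E-negative (2 * m))))
c-odd (suc m′) (suc e) _ = c-above-half refl , λ { (s≤s e≤m′) →
  c-suc (≤-<-trans (+-mono-≤ e≤m′ e≤m′) (+-monoʳ-< m′ (s≤s (m≤m+n m′ 0)))) }

lemma3p1 : (c 1 0 ≡ 1)
    × (∀ (m d : ℕ) → 1 ≤ m →
         (d > m → c (2 * m + 1) d ≡ 0)
       × (d ≤ m → c (2 * m + 1) d ≡ 2 * E (2 * m) (+ d - 1ℤ)))
lemma3p1 = refl , λ m d 1≤m →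
  subst (λ n → (d > m → c n d ≡ 0) × (d ≤ m → c n d ≡ 2 * E (2 * m) (+ d - 1ℤ)))
        (+-comm 1 (2 * m)) (c-odd m d 1≤m)
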